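{- Let $n\geq 10$ and $t\geq 3\log_2 n$ be positive integers. Then there exists an orientation $D$ of the complete bipartite graph $K_{n,n}$, with parts $X$ and $Y$, such that for every $I\subseteq X$ and $J\subseteq Y$ with $|I|=|J|=t$, the induced subdigraph $D[I\cup J]$ contains a directed cycle. -}

module Defs where

open import Data.Nat using (ℕ; suc; _≤_)
open import Data.Bool using (Bool; true; false)
open import Data.Fin using (Fin)
open import Data.Fin.Subset using (Subset; _∈_)
open import Data.Sum using (_⊎_; inj₁; inj₂)
open import Data.Product using (_×_; Σ; ∃-syntax)
open import Data.List using (List; []; _∷_; length; last)
open import Data.List.Relation.Unary.All using (All)
open import Data.List.Relation.Unary.Unique.Propositional using (Unique)
open import Data.Maybe using (just)
open import Data.Empty using (⊥)
open import Data.Unit using (⊤)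
open import Relation.Binary.PropositionalEquality using (_≡_)

-- An orientation of the complete bipartite graph K_{n,n} with parts
-- X = Fin n and Y = Fin n: every edge xy is oriented either x → y
-- (D x y ≡ true) or y → x (D x y ≡ false).
Orientation : ℕ → Set
Orientation n = Fin n → Fin n → Bool

-- Vertices of K_{n,n}: inj₁ x for x ∈ X, inj₂ y for y ∈ Y.
Vertex : ℕ → Set
Vertex n = Fin n ⊎ Fin n

Arc : ∀ {n} → Orientation n → Vertex n → Vertex n → Set
Arc D (inj₁ x) (inj₂ y) = D x y ≡ true
Arc D (inj₂ y) (inj₁ x) = D x y ≡ false
Arc D (inj₁ _) (inj₁ _) = ⊥
Arc D (inj₂ _) (inj₂ _) = ⊥

InUnion : ∀ {n} → Subset n → Subset n → Vertex n → Set
InUnion I J (inj₁ x) = x ∈ I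
InUnion I J (inj₂ y) = y ∈ J

WalkArcs : ∀ {n} → Orientation n → List (Vertex n) → Set
WalkArcs D [] = ⊤
WalkArcs D (u ∷ []) = ⊤
WalkArcs D (u ∷ v ∷ vs) = Arc D u v × WalkArcs D (v ∷ vs)

ClosingArc : ∀ {n} → Orientation n → List (Vertex n) → Set
ClosingArc D [] = ⊥
ClosingArc D (u ∷ vs) = Σ (Vertex _) λ w → (last (u ∷ vs) ≡ just w) × Arc D w u

IsDirectedCycle : ∀ {n} → Orientation n → List (Vertex n) → Set
IsDirectedCycle D vs =
  (2 ≤ length vs) × Unique vs × WalkArcs D vs × ClosingArc D vs

HasDirectedCycleIn : ∀ {n} → Orientation n → Subset n → Subset n → Set
HasDirectedCycleIn {n} D I J =
  ∃[ vs ] (All (InUnion I J) vs × IsDirectedCycle D vs)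

module Submission where

-- If D[I ∪ J] has no directed cycle, it has a topological
--    order: an enumeration of I ∪ J in which every vertex dominates all later
--    ones.  A source always exists, because without an alternating 4-cycle
--    the out-neighbourhoods of the X-vertices form a chain.
-- 2. Union bound.  Orientations are bit vectors v of length n * n.  A
--    topological order s of t + t vertices fixes the t * t edges inside it:
--    v must satisfy the partial assignment (pattern) forcedBy s, of weight at most
--    2 ^ (n * n - t * t).  There are at most (2n) ^ (2t) < 2 ^ (t * t)
--    candidate orders, so the total weight of their patterns is < 2 ^ (n * n).
-- 3. Method of conditional expectations.  Patterns on m bits of total weight
--    below 2 ^ m are avoided by some v, found bit by bit; this v encodes the
--    required orientation, since any acyclic D[I ∪ J] would produce a
--    candidate order whose pattern v satisfies.

open import Defs

open import Data.Nat as ℕ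
  using (ℕ; zero; suc; _+_; _*_; _^_; _≤_; _<_; s≤s; z≤n; z<s; NonZero; >-nonZero)
open import Data.Nat.Properties
  using (_<?_; ≤-reflexive; ≤-trans; ≮⇒≥; suc-injective; m<n⇒n≢0; m+n≡0⇒m≡0; m+n≡0⇒n≡0;
         +-identityʳ; +-suc; *-identityʳ; *-suc; *-assoc; *-comm; *-distribʳ-+;
         +-mono-≤; +-monoˡ-≤; +-cancelˡ-<; *-monoˡ-≤; *-monoʳ-≤; *-monoˡ-<; *-cancelʳ-<;
         m*n≢0; m^n≢0; ^-distribˡ-+-*; ^-*-assoc; ^-monoˡ-≤; ^-monoˡ-<; module ≤-Reasoning)
open import Data.Nat.Tactic.RingSolver using (solve-∀)
open import Data.Nat.ListAction using (sum)
open import Data.Nat.ListAction.Properties using (sum-++)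
open import Data.Bool using (Bool; true; false)
open import Data.Fin using (Fin; zero; suc; combine; splitAt; join)
open import Data.Fin.Properties using (_≟_; combine-injective; splitAt-join)
open import Data.Fin.Subset using (Subset; ∣_∣; Nonempty; Empty; _-_; ⁅_⁆; inside; outside)
  renaming (_∈_ to _∈ₛ_)
open import Data.Fin.Subset.Properties
  using (_∈?_; nonempty?; Empty-unique; ∣⊥∣≡0; p─⊥≡p; p─q⊆p)
open import Data.Vec using (Vec; []; _∷_; here; there; lookup; updateAt; replicate)
open import Data.Vec.Properties using (lookup∘updateAt; lookup∘updateAt′; lookup-replicate)
open import Data.List
  using (List; []; _∷_; length; map; foldr; concatMap; _++_; filter; allFin; cartesianProductWith)
open import Data.List.Properties
  using (map-++; length-++; length-map; length-tabulate; length-filter)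
open import Data.List.Membership.Propositional using (_∈_; find)
open import Data.List.Membership.Propositional.Properties
  using (∈-filter⁺; ∈-filter⁻; ∈-allFin; ∈-map⁺; ∈-cartesianProductWith⁺)
open import Data.List.Relation.Unary.All as All using (All; []; _∷_)
open import Data.List.Relation.Unary.All.Properties using (++⁻; map⁺; all-filter)
open import Data.List.Relation.Unary.Any as Any using (Any; here; there)
open import Data.List.Relation.Unary.AllPairs using (AllPairs; []; _∷_)
open import Data.List.Relation.Unary.Unique.Propositional using (Unique)
open import Data.Product as Product using (Σ; ∃; ∃₂; _×_; _,_; proj₁; proj₂)
open import Data.Sum as Sum using (_⊎_; inj₁; inj₂)
open import Data.Empty using (⊥; ⊥-elim)
open import Data.Unit using (⊤; tt)
open import Function using (_∘_; id)
open import Level using (0ℓ)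
open import Relation.Nullary using (¬_; Dec; yes; no; contradiction; _×-dec_)
open import Relation.Unary using (Pred; _∪_; _⊆_; ｛_｝; ∅)
open import Relation.Binary.PropositionalEquality
  using (_≡_; _≢_; refl; sym; trans; cong; cong₂; subst; module ≡-Reasoning)

Dominates : ∀ {n} → Orientation n → Vertex n → Vertex n → Set
Dominates D (inj₁ x) (inj₂ y) = D x y ≡ true
Dominates D (inj₂ y) (inj₁ x) = D x y ≡ false
Dominates D (inj₁ _) (inj₁ _) = ⊤
Dominates D (inj₂ _) (inj₂ _) = ⊤

lefts rights : ∀ {n} → List (Vertex n) → ℕ
lefts []           = 0
lefts (inj₁ _ ∷ s) = suc (lefts s)
lefts (inj₂ _ ∷ s) = lefts s
rights []           = 0
rights (inj₁ _ ∷ s) = rights s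
rights (inj₂ _ ∷ s) = suc (rights s)

length-lefts-rights : ∀ {n} (s : List (Vertex n)) → length s ≡ lefts s + rights s
length-lefts-rights []           = refl
length-lefts-rights (inj₁ _ ∷ s) = cong suc (length-lefts-rights s)
length-lefts-rights (inj₂ _ ∷ s) =
  trans (cong suc (length-lefts-rights s)) (sym (+-suc (lefts s) (rights s)))

size-empty : ∀ {n} {p : Subset n} → Empty p → ∣ p ∣ ≡ 0
size-empty {n} empty = trans (cong ∣_∣ (Empty-unique empty)) (∣⊥∣≡0 n)

positive⇒nonempty : ∀ {n} (p : Subset n) → 0 < ∣ p ∣ → Nonempty p
positive⇒nonempty p 0<∣p∣ with nonempty? p
... | yes nonempty = nonempty
... | no empty     = contradiction (size-empty empty) (m<n⇒n≢0 0<∣p∣)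

size-minus : ∀ {n} (p : Subset n) {x} → x ∈ₛ p → suc ∣ p - x ∣ ≡ ∣ p ∣
size-minus (inside  ∷ p) here = cong (suc ∘ ∣_∣) (p─⊥≡p p)
size-minus (inside  ∷ p) (there x∈p) = cong suc (size-minus p x∈p)
size-minus (outside ∷ p) (there x∈p) = size-minus p x∈p

∉-minus : ∀ {n} (p : Subset n) x → ¬ x ∈ₛ p - x
∉-minus (_ ∷ p) zero    ()
∉-minus (_ ∷ p) (suc x) (there x∈p-x) = ∉-minus p x x∈p-x

true-or-false : ∀ c → c ≡ true ⊎ c ≡ false
true-or-false true  = inj₁ refl
true-or-false false = inj₂ refl

contrapose : ∀ {c d} → (c ≡ true → d ≡ true) → d ≡ false → c ≡ false
contrapose {false} _   _ = refl
contrapose {true}  c⇒d d≡false with trans (sym (c⇒d refl)) d≡false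
... | ()

members : ∀ {n} → Subset n → List (Fin n)
members {n} I = filter (_∈? I) (allFin n)

∈-members : ∀ {n} {I : Subset n} {x} → x ∈ₛ I → x ∈ members I
∈-members {I = I} x∈I = ∈-filter⁺ (_∈? I) (∈-allFin _) x∈I

members-∈ : ∀ {n} {I : Subset n} {x} → x ∈ members I → x ∈ₛ I
members-∈ {n} {I} x∈members = proj₂ (∈-filter⁻ (_∈? I) {xs = allFin n} x∈members)

∷-members-∈ : ∀ {n} {I : Subset n} {x z} → x ∈ₛ I → z ∈ x ∷ members I → z ∈ₛ I
∷-members-∈ x∈I (here refl)        = x∈I
∷-members-∈ x∈I (there z∈members) = members-∈ z∈members

module _ {n : ℕ} (D : Orientation n) where

  record Square (P Q : Pred (Fin n) 0ℓ) : Set where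
    constructor square
    field
      {x₁ x₂ y₁ y₂} : Fin n
      x₁∈P  : P x₁
      x₂∈P  : P x₂
      y₁∈Q  : Q y₁
      y₂∈Q  : Q y₂
      x₁→y₁ : D x₁ y₁ ≡ true
      y₁→x₂ : D x₂ y₁ ≡ false
      x₂→y₂ : D x₂ y₂ ≡ true
      y₂→x₁ : D x₁ y₂ ≡ false

  square-map : ∀ {P P′ Q Q′} → P ⊆ P′ → Q ⊆ Q′ → Square P Q → Square P′ Q′
  square-map f g (square x₁∈P x₂∈P y₁∈Q y₂∈Q a b c d) =
    square (f x₁∈P) (f x₂∈P) (g y₁∈Q) (g y₂∈Q) a b c d

  square⇒cycle : ∀ {I J} → Square (_∈ₛ I) (_∈ₛ J) → HasDirectedCycleIn D I J
  square⇒cycle (square {x₁} {x₂} {y₁} {y₂} x₁∈I x₂∈I y₁∈J y₂∈J x₁→y₁ y₁→x₂ x₂→y₂ y₂→x₁) =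
    inj₁ x₁ ∷ inj₂ y₁ ∷ inj₁ x₂ ∷ inj₂ y₂ ∷ [] ,
    x₁∈I ∷ y₁∈J ∷ x₂∈I ∷ y₂∈J ∷ [] ,
    s≤s (s≤s z≤n) ,
    ((λ ()) ∷ x₁≢x₂ ∷ (λ ()) ∷ []) ∷ ((λ ()) ∷ y₁≢y₂ ∷ []) ∷ ((λ ()) ∷ []) ∷ [] ∷ [] ,
    (x₁→y₁ , y₁→x₂ , x₂→y₂ , tt) ,
    (inj₂ y₂ , refl , y₂→x₁)
    where
    x₁≢x₂ : inj₁ x₁ ≢ inj₁ x₂
    x₁≢x₂ refl with trans (sym x₁→y₁) y₁→x₂
    ... | ()
    y₁≢y₂ : inj₂ y₁ ≢ inj₂ y₂
    y₁≢y₂ refl with trans (sym x₂→y₂) y₁→x₂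
    ... | ()

  Below : Fin n → Fin n → List (Fin n) → Set
  Below x b C = All (λ y → D x y ≡ true → D b y ≡ true) C

  below-refl : ∀ x C → Below x x C
  below-refl x = All.universal (λ _ x→y → x→y)

  below-trans : ∀ {x b c C} → Below x b C → Below b c C → Below x c C
  below-trans x≤b b≤c = All.zipWith (λ (f , g) → g ∘ f) (x≤b , b≤c)

  below-or-witness : ∀ x b C → Below x b C ⊎ Any (λ y → D x y ≡ true × D b y ≡ false) C
  below-or-witness x b = All.decide compare
    where
    compare : ∀ y → (D x y ≡ true → D b y ≡ true) ⊎ (D x y ≡ true × D b y ≡ false)
    compare y with D x y | D b y
    ... | false | _     = inj₁ λ ()
    ... | true  | true  = inj₁ λ _ → refl
    ... | true  | false = inj₂ (refl , refl)

  -- Without an alternating 4-cycle the out-neighbourhoods of R (within C)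
  -- form a chain, so one vertex b of R has the largest of them.
  largest : ∀ r R C → Square (λ x → x ∈ r ∷ R) (_∈ C)
    ⊎ ∃ λ b → b ∈ r ∷ R × All (λ x → Below x b C) (r ∷ R)
  largest r [] C = inj₂ (r , here refl , below-refl r C ∷ [])
  largest r (x ∷ R) C with largest x R C
  ... | inj₁ sq = inj₁ (square-map there (λ y∈C → y∈C) sq)
  ... | inj₂ (b , b∈R , R≤b) with below-or-witness r b C
  ...   | inj₁ r≤b = inj₂ (b , there b∈R , r≤b ∷ R≤b)
  ...   | inj₂ r≰b with below-or-witness b r C
  ...     | inj₁ b≤r =
                inj₂ (r , here refl , below-refl r C ∷ All.map (λ x≤b → below-trans x≤b b≤r) R≤b)
  ...     | inj₂ b≰r with find r≰b | find b≰r
  ...       | y₁ , y₁∈C , r→y₁ , y₁→b | y₂ , y₂∈C , b→y₂ , y₂→r =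
                inj₁ (square (here refl) (there b∈R) y₁∈C y₂∈C r→y₁ y₁→b b→y₂ y₂→r)

  -- Without an alternating 4-cycle, some x ∈ R beats all of C or some y ∈ C
  -- beats all of R: if b (as above) misses y ∈ C, then y beats every x ∈ R.
  source-or-square : ∀ r R C → Square (λ x → x ∈ r ∷ R) (_∈ C)
    ⊎ (∃ λ x → x ∈ r ∷ R × All (λ y → D x y ≡ true) C)
    ⊎ (∃ λ y → y ∈ C × All (λ x → D x y ≡ false) (r ∷ R))
  source-or-square r R C with largest r R C
  ... | inj₁ sq = inj₁ sq
  ... | inj₂ (b , b∈R , R≤b) with All.decide (λ y → true-or-false (D b y)) C
  ...   | inj₁ b→C = inj₂ (inj₁ (b , b∈R , b→C))
  ...   | inj₂ C↛b with find C↛b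
  ...     | y , y∈C , y→b =
                inj₂ (inj₂ (y , y∈C , All.map (λ x≤b → contrapose (All.lookup x≤b y∈C) y→b) R≤b))

  Source : Subset n → Subset n → Vertex n → Set
  Source I J u = InUnion I J u × (∀ {w} → InUnion I J w → Dominates D u w)

  cycle-or-source : ∀ I J → 0 < ∣ I ∣ + ∣ J ∣ → HasDirectedCycleIn D I J ⊎ ∃ (Source I J)
  cycle-or-source I J nonempty with nonempty? I
  ... | no I-empty
      with positive⇒nonempty J (subst (λ k → 0 < k + ∣ J ∣) (size-empty I-empty) nonempty)
  ...   | y , y∈J = inj₂ (inj₂ y , y∈J , dominates)
    where
    dominates : ∀ {w} → InUnion I J w → Dominates D (inj₂ y) w
    dominates {inj₁ x} x∈I = ⊥-elim (I-empty (x , x∈I))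
    dominates {inj₂ _} _   = tt
  cycle-or-source I J nonempty | yes (x , x∈I) with source-or-square x (members I) (members J)
  ... | inj₁ sq = inj₁ (square⇒cycle (square-map (∷-members-∈ x∈I) members-∈ sq))
  ... | inj₂ (inj₁ (x′ , x′∈R , x′→C)) = inj₂ (inj₁ x′ , ∷-members-∈ x∈I x′∈R , dominates)
    where
    dominates : ∀ {w} → InUnion I J w → Dominates D (inj₁ x′) w
    dominates {inj₁ _} _   = tt
    dominates {inj₂ y} y∈J = All.lookup x′→C (∈-members y∈J)
  ... | inj₂ (inj₂ (y , y∈C , R→y)) = inj₂ (inj₂ y , members-∈ y∈C , dominates)
    where
    dominates : ∀ {w} → InUnion I J w → Dominates D (inj₂ y) w
    dominates {inj₁ z} z∈I = All.lookup R→y (there (∈-members z∈I))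
    dominates {inj₂ _} _   = tt

  record TopologicalOrder (I J : Subset n) : Set where
    field
      order    : List (Vertex n)
      within   : All (InUnion I J) order
      distinct : Unique order
      forward  : AllPairs (Dominates D) order
      #lefts   : lefts order ≡ ∣ I ∣
      #rights  : rights order ≡ ∣ J ∣
  open TopologicalOrder

  cycle-mono : ∀ {I J I′ J′} → InUnion I′ J′ ⊆ InUnion I J →
    HasDirectedCycleIn D I′ J′ → HasDirectedCycleIn D I J
  cycle-mono sub (vs , vs-within , cycle) = vs , All.map sub vs-within , cycle

  prepend : ∀ {I J I′ J′ u} → Source I J u → InUnion I′ J′ ⊆ InUnion I J → ¬ InUnion I′ J′ u →
    (o : TopologicalOrder I′ J′) → lefts (u ∷ order o) ≡ ∣ I ∣ → rights (u ∷ order o) ≡ ∣ J ∣ →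
    TopologicalOrder I J
  prepend {I′ = I′} {J′} (u∈ , dominates) sub u∉ o #l #r = record
    { order    = _ ∷ order o
    ; within   = u∈ ∷ All.map sub (within o)
    ; distinct = All.map (λ w∈ u≡w → u∉ (subst (InUnion I′ J′) (sym u≡w) w∈)) (within o)
                 ∷ distinct o
    ; forward  = All.map (dominates ∘ sub) (within o) ∷ forward o
    ; #lefts   = #l
    ; #rights  = #r
    }

  minus-left : ∀ (I J : Subset n) x → InUnion (I - x) J ⊆ InUnion I J
  minus-left I J x {inj₁ z} z∈I-x = p─q⊆p I ⁅ x ⁆ z∈I-x
  minus-left I J x {inj₂ _} y∈J   = y∈J

  minus-right : ∀ (I J : Subset n) y → InUnion I (J - y) ⊆ InUnion I J
  minus-right I J y {inj₁ _} x∈I   = x∈I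
  minus-right I J y {inj₂ z} z∈J-y = p─q⊆p J ⁅ y ⁆ z∈J-y

  cycle-or-order : ∀ k (I J : Subset n) → ∣ I ∣ + ∣ J ∣ ≡ k →
    HasDirectedCycleIn D I J ⊎ TopologicalOrder I J
  cycle-or-order zero I J size = inj₂ (record
    { order = [] ; within = [] ; distinct = [] ; forward = []
    ; #lefts = sym (m+n≡0⇒m≡0 ∣ I ∣ size) ; #rights = sym (m+n≡0⇒n≡0 ∣ I ∣ size) })
  cycle-or-order (suc k) I J size with cycle-or-source I J (subst (0 <_) (sym size) z<s)
  ... | inj₁ cycle = inj₁ cycle
  ... | inj₂ (inj₁ x , source@(x∈I , _))
      with cycle-or-order k (I - x) J
             (suc-injective (trans (cong (_+ ∣ J ∣) (size-minus I x∈I)) size))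
  ...   | inj₁ cycle = inj₁ (cycle-mono (minus-left I J x) cycle)
  ...   | inj₂ o = inj₂ (prepend source (minus-left I J x) (∉-minus I x) o
                          (trans (cong suc (#lefts o)) (size-minus I x∈I)) (#rights o))
  cycle-or-order (suc k) I J size | inj₂ (inj₂ y , source@(y∈J , _))
      with cycle-or-order k I (J - y) (suc-injective (begin
             suc (∣ I ∣ + ∣ J - y ∣)  ≡⟨ +-suc ∣ I ∣ ∣ J - y ∣ ⟨
             ∣ I ∣ + suc ∣ J - y ∣    ≡⟨ cong (∣ I ∣ +_) (size-minus J y∈J) ⟩
             ∣ I ∣ + ∣ J ∣            ≡⟨ size ⟩
             suc k                    ∎))
    where open ≡-Reasoning
  ...   | inj₁ cycle = inj₁ (cycle-mono (minus-right I J y) cycle)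
  ...   | inj₂ o = inj₂ (prepend source (minus-right I J y) (∉-minus J y) o
                          (#lefts o) (trans (cong suc (#rights o)) (size-minus J y∈J)))

-- A pattern is a partial assignment of m bits: each cell is free, fixed to
-- a value, or void (unsatisfiable).
data Cell : Set where
  free  : Cell
  fixed : Bool → Cell
  void  : Cell

Pattern : ℕ → Set
Pattern m = Vec Cell m

Assignment : ℕ → Set
Assignment m = Vec Bool m

Admits : Cell → Bool → Set
Admits free      _ = ⊤
Admits (fixed b) c = c ≡ b
Admits void      _ = ⊥

Satisfies : ∀ {m} → Assignment m → Pattern m → Set
Satisfies v K = ∀ q → Admits (lookup K q) (lookup v q)

Avoids : ∀ {m} → Assignment m → List (Pattern m) → Set
Avoids v Ks = All (λ K → ¬ Satisfies v K) Ks

-- The weight of a pattern counts the assignments satisfying it (a factor 2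
-- per free cell), so a random assignment satisfies K with probability
-- weight K / 2 ^ m.
cellWeight : Cell → ℕ
cellWeight free      = 2
cellWeight (fixed _) = 1
cellWeight void      = 0

weight : ∀ {m} → Pattern m → ℕ
weight []      = 1
weight (c ∷ K) = cellWeight c * weight K

totalWeight : ∀ {m} → List (Pattern m) → ℕ
totalWeight Ks = sum (map weight Ks)

totalWeight-++ : ∀ {m} (Ks Ls : List (Pattern m)) →
  totalWeight (Ks ++ Ls) ≡ totalWeight Ks + totalWeight Ls
totalWeight-++ Ks Ls =
  trans (cong sum (map-++ weight Ks Ls)) (sum-++ (map weight Ks) (map weight Ls))

restrict : ∀ {m} → Bool → Pattern (suc m) → List (Pattern m)
restrict _     (free        ∷ K) = K ∷ []
restrict false (fixed false ∷ K) = K ∷ []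
restrict true  (fixed true  ∷ K) = K ∷ []
restrict false (fixed true  ∷ K) = []
restrict true  (fixed false ∷ K) = []
restrict _     (void        ∷ K) = []

restrictAll : ∀ {m} → Bool → List (Pattern (suc m)) → List (Pattern m)
restrictAll b = concatMap (restrict b)

restrict-weight : ∀ {m} (K : Pattern (suc m)) →
  totalWeight (restrict false K) + totalWeight (restrict true K) ≡ weight K
restrict-weight (free        ∷ K) = double (weight K)
  where
  double : ∀ w → (w + 0) + (w + 0) ≡ 2 * w
  double = solve-∀
restrict-weight (fixed false ∷ K) = +-identityʳ (weight K + 0)
restrict-weight (fixed true  ∷ K) = refl
restrict-weight (void        ∷ K) = refl

restrictAll-weight : ∀ {m} (Ks : List (Pattern (suc m))) →
  totalWeight (restrictAll false Ks) + totalWeight (restrictAll true Ks) ≡ totalWeight Ks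
restrictAll-weight [] = refl
restrictAll-weight (K ∷ Ks) = begin
    totalWeight (restrict false K ++ restrictAll false Ks)
      + totalWeight (restrict true K ++ restrictAll true Ks)
  ≡⟨ cong₂ _+_ (totalWeight-++ (restrict false K) _) (totalWeight-++ (restrict true K) _) ⟩
    (totalWeight (restrict false K) + totalWeight (restrictAll false Ks))
      + (totalWeight (restrict true K) + totalWeight (restrictAll true Ks))
  ≡⟨ interchange (totalWeight (restrict false K)) (totalWeight (restrictAll false Ks))
                   (totalWeight (restrict true K)) (totalWeight (restrictAll true Ks)) ⟩
    (totalWeight (restrict false K) + totalWeight (restrict true K))
      + (totalWeight (restrictAll false Ks) + totalWeight (restrictAll true Ks))
  ≡⟨ cong₂ _+_ (restrict-weight K) (restrictAll-weight Ks) ⟩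
    weight K + totalWeight Ks
  ∎
  where
  open ≡-Reasoning
  interchange : ∀ a b c d → (a + b) + (c + d) ≡ (a + c) + (b + d)
  interchange = solve-∀

restrict-complete : ∀ {m} c b (K : Pattern m) → Admits c b → K ∈ restrict b (c ∷ K)
restrict-complete free      b     K _    = here refl
restrict-complete (fixed _) false K refl = here refl
restrict-complete (fixed _) true  K refl = here refl

avoids-extend : ∀ {m} b (v : Assignment m) (Ks : List (Pattern (suc m))) →
  Avoids v (restrictAll b Ks) → Avoids (b ∷ v) Ks
avoids-extend b v [] _ = []
avoids-extend b v ((c ∷ K) ∷ Ks) avoids with ++⁻ (restrict b (c ∷ K)) avoids
... | avoidsHead , avoidsRest =
  (λ sat → All.lookup avoidsHead (restrict-complete c b K (sat zero)) (λ q → sat (suc q)))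
  ∷ avoids-extend b v Ks avoidsRest

other-half : ∀ a b c → a + b < 2 * c → c ≤ a → b < c
other-half a b c a+b<2c c≤a = +-cancelˡ-< c b c (begin-strict
  c + b  ≤⟨ +-monoˡ-≤ b c≤a ⟩
  a + b  <⟨ a+b<2c ⟩
  2 * c  ≡⟨ cong (c +_) (+-identityʳ c) ⟩
  c + c  ∎)
  where open ≤-Reasoning

smaller-half : ∀ {m} (Ks : List (Pattern (suc m))) → totalWeight Ks < 2 ^ suc m →
  ∃ λ b → totalWeight (restrictAll b Ks) < 2 ^ m
smaller-half {m} Ks bound with totalWeight (restrictAll false Ks) <? 2 ^ m
... | yes small = false , small
... | no ¬small = true , other-half _ _ (2 ^ m)
                           (subst (_< 2 ^ suc m) (sym (restrictAll-weight Ks)) bound)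
                           (≮⇒≥ ¬small)

-- Fix the bits one at a time, always choosing the half of smaller weight.
avoid : ∀ m (Ks : List (Pattern m)) → totalWeight Ks < 2 ^ m → ∃ λ v → Avoids v Ks
avoid zero    []        _        = [] , []
avoid zero    ([] ∷ Ks) (s≤s ())
avoid (suc m) Ks        bound with smaller-half Ks bound
... | b , small with avoid m (restrictAll b Ks) small
...   | v , avoids = b ∷ v , avoids-extend b v Ks avoids

-- Fixing a cell to b: a free cell becomes fixed, a constrained one becomes
-- unsatisfiable (so that fixing never needs to know what is already there).
fix : Bool → Cell → Cell
fix b free      = fixed b
fix b (fixed _) = void
fix b void      = void

fixAt : ∀ {m} → Fin m → Bool → Pattern m → Pattern m
fixAt p b K = updateAt K p (fix b)

-- K′ is smaller than K by a factor 2 ^ e: each freshly fixed bit halves the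
-- number of satisfying assignments.
record Shrinks {m} (e : ℕ) (K′ K : Pattern m) : Set where
  constructor shrinks
  field bound : weight K′ * 2 ^ e ≤ weight K
open Shrinks

shrinks-refl : ∀ {m} (K : Pattern m) → Shrinks 0 K K
shrinks-refl K = shrinks (≤-reflexive (*-identityʳ (weight K)))

shrinks-trans : ∀ {m} d e {K″ K′ K : Pattern m} →
  Shrinks d K″ K′ → Shrinks e K′ K → Shrinks (d + e) K″ K
shrinks-trans d e {K″} {K′} {K} K″≤K′ K′≤K = shrinks (begin
  weight K″ * 2 ^ (d + e)        ≡⟨ cong (weight K″ *_) (^-distribˡ-+-* 2 d e) ⟩
  weight K″ * (2 ^ d * 2 ^ e)    ≡⟨ *-assoc (weight K″) (2 ^ d) (2 ^ e) ⟨
  weight K″ * 2 ^ d * 2 ^ e      ≤⟨ *-monoˡ-≤ (2 ^ e) (bound K″≤K′) ⟩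
  weight K′ * 2 ^ e              ≤⟨ bound K′≤K ⟩
  weight K                       ∎)
  where open ≤-Reasoning

fix-halves : ∀ b c → cellWeight (fix b c) * 2 ≤ cellWeight c
fix-halves b free      = ≤-reflexive refl
fix-halves b (fixed _) = z≤n
fix-halves b void      = z≤n

weight-fixAt : ∀ {m} (p : Fin m) b (K : Pattern m) → weight (fixAt p b K) * 2 ≤ weight K
weight-fixAt zero b (c ∷ K) = begin
  cellWeight (fix b c) * weight K * 2   ≡⟨ swap (cellWeight (fix b c)) (weight K) ⟩
  cellWeight (fix b c) * 2 * weight K   ≤⟨ *-monoˡ-≤ (weight K) (fix-halves b c) ⟩
  cellWeight c * weight K               ∎
  where
  open ≤-Reasoning
  swap : ∀ x y → x * y * 2 ≡ x * 2 * y
  swap = solve-∀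
weight-fixAt (suc p) b (c ∷ K) = begin
  cellWeight c * weight (fixAt p b K) * 2   ≡⟨ *-assoc (cellWeight c) _ 2 ⟩
  cellWeight c * (weight (fixAt p b K) * 2) ≤⟨ *-monoʳ-≤ (cellWeight c) (weight-fixAt p b K) ⟩
  cellWeight c * weight K                   ∎
  where open ≤-Reasoning

fixAt-shrinks : ∀ {m} (p : Fin m) b (K : Pattern m) → Shrinks 1 (fixAt p b K) K
fixAt-shrinks p b K = shrinks (weight-fixAt p b K)

weight-free : ∀ m → weight (replicate m free) ≡ 2 ^ m
weight-free zero    = refl
weight-free (suc m) = cong (2 *_) (weight-free m)

record Consistent {m} (v : Assignment m) (P : Pred (Fin m) 0ℓ) (K : Pattern m) : Set where
  constructor consistent
  field cellwise : ∀ q → lookup K q ≡ free ⊎ (P q × lookup K q ≡ fixed (lookup v q))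
open Consistent

consistent-free : ∀ {m} (v : Assignment m) P → Consistent v P (replicate m free)
consistent-free v P = consistent λ q → inj₁ (lookup-replicate q free)

consistent-mono : ∀ {m} {v : Assignment m} {P Q K} → P ⊆ Q → Consistent v P K → Consistent v Q K
consistent-mono P⊆Q con = consistent λ q → Sum.map₂ (Product.map₁ P⊆Q) (cellwise con q)

consistent-fixAt : ∀ {m} {v : Assignment m} {P K} p {b} → Consistent v P K → ¬ P p →
  lookup v p ≡ b → Consistent v (P ∪ ｛ p ｝) (fixAt p b K)
consistent-fixAt {v = v} {P} {K} p {b} con p∉P vp≡b = consistent at
  where
  at : ∀ q → lookup (fixAt p b K) q ≡ free
           ⊎ ((P ∪ ｛ p ｝) q × lookup (fixAt p b K) q ≡ fixed (lookup v q))
  at q with q ≟ p | cellwise con p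
  ... | yes refl | inj₂ (p∈P , _) = contradiction p∈P p∉P
  ... | yes refl | inj₁ isFree    = inj₂ (inj₂ refl , (begin
    lookup (fixAt p b K) p  ≡⟨ lookup∘updateAt p K ⟩
    fix b (lookup K p)      ≡⟨ cong (fix b) isFree ⟩
    fixed b                 ≡⟨ cong fixed vp≡b ⟨
    fixed (lookup v p)      ∎))
    where open ≡-Reasoning
  ... | no q≢p | _ with cellwise con q
  ...   | inj₁ isFree          = inj₁ (trans (lookup∘updateAt′ q p q≢p K) isFree)
  ...   | inj₂ (q∈P , isFixed) = inj₂ (inj₁ q∈P , trans (lookup∘updateAt′ q p q≢p K) isFixed)

consistent⇒satisfies : ∀ {m} {v : Assignment m} {P K} → Consistent v P K → Satisfies v K
consistent⇒satisfies {v = v} {K = K} con q with cellwise con q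
... | inj₁ isFree       rewrite isFree  = tt
... | inj₂ (_ , isFixed) rewrite isFixed = refl

orientationOf : ∀ {n} → Assignment (n * n) → Orientation n
orientationOf v x y = lookup v (combine x y)

module _ {n : ℕ} where

  EdgeCell : Vertex n → Vertex n → Pred (Fin (n * n)) 0ℓ
  EdgeCell (inj₁ x) (inj₂ y) = ｛ combine x y ｝
  EdgeCell (inj₂ y) (inj₁ x) = ｛ combine x y ｝
  EdgeCell (inj₁ _) (inj₁ _) = ∅
  EdgeCell (inj₂ _) (inj₂ _) = ∅

  edgeCell-injective : ∀ u {w w′ q} → EdgeCell u w q → EdgeCell u w′ q → w ≡ w′
  edgeCell-injective (inj₁ x) {inj₂ y} {inj₂ y′} refl e with combine-injective x y′ x y e
  ... | _ , refl = refl
  edgeCell-injective (inj₂ y) {inj₁ x} {inj₁ x′} refl e with combine-injective x′ y x y e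
  ... | refl , _ = refl

  Covered : List (Vertex n) → Pred (Fin (n * n)) 0ℓ
  Covered s q = ∃₂ λ x y → combine x y ≡ q × inj₁ x ∈ s × inj₂ y ∈ s

  edgeCell-covered : ∀ {s} u w {q} → EdgeCell u w q → u ∈ s → w ∈ s → Covered s q
  edgeCell-covered (inj₁ x) (inj₂ y) e u∈s w∈s = x , y , e , u∈s , w∈s
  edgeCell-covered (inj₂ y) (inj₁ x) e u∈s w∈s = x , y , e , w∈s , u∈s

  edgeCell-endpoint : ∀ {s} u w {q} → EdgeCell u w q → Covered s q → u ∈ s
  edgeCell-endpoint (inj₁ x) (inj₂ y) refl (x′ , y′ , e , x′∈s , _)
    with combine-injective x′ y′ x y e
  ... | refl , _ = x′∈s
  edgeCell-endpoint (inj₂ y) (inj₁ x) refl (x′ , y′ , e , _ , y′∈s)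
    with combine-injective x′ y′ x y e
  ... | _ , refl = y′∈s

  fixArc : Vertex n → Vertex n → Pattern (n * n) → Pattern (n * n)
  fixArc (inj₁ x) (inj₂ y) = fixAt (combine x y) true
  fixArc (inj₂ y) (inj₁ x) = fixAt (combine x y) false
  fixArc (inj₁ _) (inj₁ _) K = K
  fixArc (inj₂ _) (inj₂ _) K = K

  fixRow : Vertex n → List (Vertex n) → Pattern (n * n) → Pattern (n * n)
  fixRow u ws K = foldr (fixArc u) K ws

  forcedBy : List (Vertex n) → Pattern (n * n)
  forcedBy []      = replicate (n * n) free
  forcedBy (u ∷ s) = fixRow u s (forcedBy s)

  across : Vertex n → List (Vertex n) → ℕ
  across (inj₁ _) ws = rights ws
  across (inj₂ _) ws = lefts ws

  fixRow-shrinks : ∀ u ws K → Shrinks (across u ws) (fixRow u ws K) K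
  fixRow-shrinks (inj₁ _) [] K = shrinks-refl K
  fixRow-shrinks (inj₂ _) [] K = shrinks-refl K
  fixRow-shrinks (inj₁ x) (inj₂ y ∷ ws) K =
    shrinks-trans 1 (rights ws) (fixAt-shrinks (combine x y) true _) (fixRow-shrinks (inj₁ x) ws K)
  fixRow-shrinks (inj₂ y) (inj₁ x ∷ ws) K =
    shrinks-trans 1 (lefts ws) (fixAt-shrinks (combine x y) false _) (fixRow-shrinks (inj₂ y) ws K)
  fixRow-shrinks (inj₁ x) (inj₁ _ ∷ ws) K = fixRow-shrinks (inj₁ x) ws K
  fixRow-shrinks (inj₂ y) (inj₂ _ ∷ ws) K = fixRow-shrinks (inj₂ y) ws K

  forcedBy-shrinks : ∀ s → Shrinks (lefts s * rights s) (forcedBy s) (replicate (n * n) free)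
  forcedBy-shrinks [] = shrinks-refl _
  forcedBy-shrinks (inj₁ x ∷ s) =
    shrinks-trans (rights s) (lefts s * rights s) (fixRow-shrinks (inj₁ x) s _) (forcedBy-shrinks s)
  forcedBy-shrinks (inj₂ y ∷ s) =
    subst (λ e → Shrinks e (forcedBy (inj₂ y ∷ s)) (replicate (n * n) free))
      (sym (*-suc (lefts s) (rights s)))
      (shrinks-trans (lefts s) (lefts s * rights s)
        (fixRow-shrinks (inj₂ y) s _) (forcedBy-shrinks s))

  fixArc-consistent : ∀ {v P K} u w → Consistent v P K → (∀ {q} → EdgeCell u w q → ¬ P q) →
    Dominates (orientationOf v) u w → Consistent v (P ∪ EdgeCell u w) (fixArc u w K)
  fixArc-consistent (inj₁ x) (inj₂ y) con fresh arc =
    consistent-fixAt (combine x y) con (fresh refl) arc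
  fixArc-consistent (inj₂ y) (inj₁ x) con fresh arc =
    consistent-fixAt (combine x y) con (fresh refl) arc
  fixArc-consistent (inj₁ _) (inj₁ _) con fresh arc = consistent-mono inj₁ con
  fixArc-consistent (inj₂ _) (inj₂ _) con fresh arc = consistent-mono inj₁ con

  RowCells : Vertex n → List (Vertex n) → Pred (Fin (n * n)) 0ℓ
  RowCells u ws q = Any (λ w → EdgeCell u w q) ws

  fixRow-consistent : ∀ {v P K} u ws → Consistent v P K →
    (∀ {w q} → w ∈ ws → EdgeCell u w q → ¬ P q) →
    Unique ws → All (Dominates (orientationOf v) u) ws →
    Consistent v (P ∪ RowCells u ws) (fixRow u ws K)
  fixRow-consistent u [] con fresh [] [] = consistent-mono inj₁ con
  fixRow-consistent {P = P} u (w ∷ ws) con fresh (w∉ws ∷ distinct) (dom ∷ doms) =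
    consistent-mono regroup
      (fixArc-consistent u w (fixRow-consistent u ws con (fresh ∘ there) distinct doms) fresh′ dom)
    where
    fresh′ : ∀ {q} → EdgeCell u w q → ¬ (P ∪ RowCells u ws) q
    fresh′ e (inj₁ q∈P) = fresh (here refl) e q∈P
    fresh′ e (inj₂ row) = All.lookup w∉ws (Any.map (edgeCell-injective u e) row) refl
    regroup : (P ∪ RowCells u ws) ∪ EdgeCell u w ⊆ P ∪ RowCells u (w ∷ ws)
    regroup (inj₁ (inj₁ q∈P)) = inj₁ q∈P
    regroup (inj₁ (inj₂ row)) = inj₂ (there row)
    regroup (inj₂ e)          = inj₂ (here e)

  forcedBy-consistent : ∀ {v} s → Unique s → AllPairs (Dominates (orientationOf v)) s →
    Consistent v (Covered s) (forcedBy s)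
  forcedBy-consistent [] _ _ = consistent-free _ _
  forcedBy-consistent {v} (u ∷ s) (u∉s ∷ distinct) (dom ∷ doms) =
    consistent-mono widen
      (fixRow-consistent u s (forcedBy-consistent s distinct doms) fresh distinct dom)
    where
    fresh : ∀ {w q} → w ∈ s → EdgeCell u w q → ¬ Covered s q
    fresh {w} _ e covered = All.lookup u∉s (edgeCell-endpoint u w e covered) refl
    widen : Covered s ∪ RowCells u s ⊆ Covered (u ∷ s)
    widen (inj₁ (x , y , e , x∈s , y∈s)) = x , y , e , there x∈s , there y∈s
    widen (inj₂ row) with find row
    ... | w , w∈s , e = edgeCell-covered u w e (here refl) (there w∈s)

words : ∀ {A : Set} → List A → ℕ → List (List A)
words as zero    = [] ∷ []
words as (suc k) = cartesianProductWith _∷_ as (words as k)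

length-cartesianProductWith : ∀ {A B C : Set} (f : A → B → C) xs ys →
  length (cartesianProductWith f xs ys) ≡ length xs * length ys
length-cartesianProductWith f []       ys = refl
length-cartesianProductWith f (x ∷ xs) ys = trans (length-++ (map (f x) ys))
  (cong₂ _+_ (length-map (f x) ys) (length-cartesianProductWith f xs ys))

length-words : ∀ {A : Set} (as : List A) k → length (words as k) ≡ length as ^ k
length-words as zero    = refl
length-words as (suc k) = trans (length-cartesianProductWith _∷_ as (words as k))
  (cong (length as *_) (length-words as k))

∈-words : ∀ {A : Set} {as : List A} → (∀ a → a ∈ as) → ∀ s → s ∈ words as (length s)
∈-words every []      = here refl
∈-words every (a ∷ s) = ∈-cartesianProductWith⁺ _∷_ (every a) (∈-words every s)

vertices : ∀ n → List (Vertex n)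
vertices n = map (splitAt n) (allFin (n + n))

length-vertices : ∀ n → length (vertices n) ≡ n + n
length-vertices n = trans (length-map (splitAt n) (allFin (n + n))) (length-tabulate id)

∈-vertices : ∀ {n} (u : Vertex n) → u ∈ vertices n
∈-vertices {n} u =
  subst (_∈ vertices n) (splitAt-join n n u) (∈-map⁺ (splitAt n) (∈-allFin (join n n u)))

Balanced : ∀ {n} → ℕ → List (Vertex n) → Set
Balanced t s = lefts s ≡ t × rights s ≡ t

balanced? : ∀ {n} t (s : List (Vertex n)) → Dec (Balanced t s)
balanced? t s = (lefts s ℕ.≟ t) ×-dec (rights s ℕ.≟ t)

candidates : ∀ n → ℕ → List (List (Vertex n))
candidates n t = filter (balanced? t) (words (vertices n) (t + t))

length-candidates : ∀ n t → length (candidates n t) ≤ (n + n) ^ (t + t)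
length-candidates n t = begin
  length (candidates n t)              ≤⟨ length-filter (balanced? t) (words (vertices n) (t + t)) ⟩
  length (words (vertices n) (t + t))  ≡⟨ length-words (vertices n) (t + t) ⟩
  length (vertices n) ^ (t + t)        ≡⟨ cong (_^ (t + t)) (length-vertices n) ⟩
  (n + n) ^ (t + t)                    ∎
  where open ≤-Reasoning

order-candidate : ∀ {n t} {D : Orientation n} {I J} (o : TopologicalOrder D I J) →
  ∣ I ∣ ≡ t → ∣ J ∣ ≡ t → TopologicalOrder.order o ∈ candidates n t
order-candidate {n} {t} o ∣I∣≡t ∣J∣≡t =
  ∈-filter⁺ (balanced? t) (subst (order o ∈_) (cong (words (vertices n)) length≡) word) balanced
  where
  open TopologicalOrder
  balanced : Balanced t (order o)
  balanced = trans (#lefts o) ∣I∣≡t , trans (#rights o) ∣J∣≡t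
  word : order o ∈ words (vertices n) (length (order o))
  word = ∈-words ∈-vertices (order o)
  length≡ : length (order o) ≡ t + t
  length≡ = trans (length-lefts-rights (order o)) (cong₂ _+_ (proj₁ balanced) (proj₂ balanced))

forcedBy-weight : ∀ {n t} (s : List (Vertex n)) → Balanced t s →
  weight (forcedBy s) * 2 ^ (t * t) ≤ 2 ^ (n * n)
forcedBy-weight {n} {t} s (lefts≡t , rights≡t) = begin
  weight (forcedBy s) * 2 ^ (t * t)
    ≡⟨ cong (λ e → weight (forcedBy s) * 2 ^ e) (cong₂ _*_ lefts≡t rights≡t) ⟨
  weight (forcedBy s) * 2 ^ (lefts s * rights s)  ≤⟨ bound (forcedBy-shrinks s) ⟩
  weight (replicate (n * n) free)                 ≡⟨ weight-free (n * n) ⟩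
  2 ^ (n * n)                                     ∎
  where open ≤-Reasoning

totalWeight-bound : ∀ {m} c N (Ks : List (Pattern m)) → All (λ K → weight K * c ≤ N) Ks →
  totalWeight Ks * c ≤ length Ks * N
totalWeight-bound c N []       []       = z≤n
totalWeight-bound c N (K ∷ Ks) (K≤N ∷ Ks≤N) = begin
  (weight K + totalWeight Ks) * c      ≡⟨ *-distribʳ-+ c (weight K) (totalWeight Ks) ⟩
  weight K * c + totalWeight Ks * c    ≤⟨ +-mono-≤ K≤N (totalWeight-bound c N Ks Ks≤N) ⟩
  N + length Ks * N                    ∎
  where open ≤-Reasoning

square-below-cube : ∀ n → 5 ≤ n → (n + n) ^ 2 < n ^ 3
square-below-cube n 5≤n = begin-strict
  (n + n) ^ 2    ≡⟨ four-squares n ⟩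
  4 * (n * n)    <⟨ *-monoˡ-< (n * n) {{m*n≢0 n n {{n≢0}} {{n≢0}}}} 5≤n ⟩
  n * (n * n)    ≡⟨ cube n ⟨
  n ^ 3          ∎
  where
  open ≤-Reasoning
  n≢0 : NonZero n
  n≢0 = >-nonZero (≤-trans (s≤s z≤n) 5≤n)
  four-squares : ∀ n → (n + n) * ((n + n) * 1) ≡ 4 * (n * n)
  four-squares = solve-∀
  cube : ∀ n → n * (n * (n * 1)) ≡ n * (n * n)
  cube = solve-∀

few-candidates : ∀ n t → 5 ≤ n → 1 ≤ t → n ^ 3 ≤ 2 ^ t → (n + n) ^ (t + t) < 2 ^ (t * t)
few-candidates n t 5≤n 1≤t n³≤2ᵗ = begin-strict
  (n + n) ^ (t + t)      ≡⟨ cong ((n + n) ^_) (cong (t +_) (+-identityʳ t)) ⟨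
  (n + n) ^ (2 * t)      ≡⟨ ^-*-assoc (n + n) 2 t ⟨
  ((n + n) ^ 2) ^ t      <⟨ ^-monoˡ-< t {{>-nonZero 1≤t}} (square-below-cube n 5≤n) ⟩
  (n ^ 3) ^ t            ≤⟨ ^-monoˡ-≤ t n³≤2ᵗ ⟩
  (2 ^ t) ^ t            ≡⟨ ^-*-assoc 2 t t ⟩
  2 ^ (t * t)            ∎
  where open ≤-Reasoning

candidates-light : ∀ n t → 5 ≤ n → 1 ≤ t → n ^ 3 ≤ 2 ^ t →
  totalWeight (map forcedBy (candidates n t)) < 2 ^ (n * n)
candidates-light n t 5≤n 1≤t n³≤2ᵗ = *-cancelʳ-< (2 ^ (t * t)) _ _ (begin-strict
  totalWeight Ks * 2 ^ (t * t)     ≤⟨ totalWeight-bound (2 ^ (t * t)) (2 ^ (n * n)) Ks each-light ⟩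
  length Ks * 2 ^ (n * n)          ≤⟨ *-monoˡ-≤ (2 ^ (n * n)) few-patterns ⟩
  (n + n) ^ (t + t) * 2 ^ (n * n)  <⟨ *-monoˡ-< (2 ^ (n * n)) {{m^n≢0 2 (n * n)}}
                                                 (few-candidates n t 5≤n 1≤t n³≤2ᵗ) ⟩
  2 ^ (t * t) * 2 ^ (n * n)        ≡⟨ *-comm (2 ^ (t * t)) (2 ^ (n * n)) ⟩
  2 ^ (n * n) * 2 ^ (t * t)        ∎)
  where
  open ≤-Reasoning
  Ks : List (Pattern (n * n))
  Ks = map forcedBy (candidates n t)
  each-light : All (λ K → weight K * 2 ^ (t * t) ≤ 2 ^ (n * n)) Ks
  each-light = map⁺ (All.map (λ {s} → forcedBy-weight s)
                             (all-filter (balanced? t) (words (vertices n) (t + t))))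
  few-patterns : length Ks ≤ (n + n) ^ (t + t)
  few-patterns = ≤-trans (≤-reflexive (length-map forcedBy (candidates n t))) (length-candidates n t)

-- An assignment avoiding all forced patterns encodes an orientation in which
-- every D[I ∪ J] with ∣ I ∣ = ∣ J ∣ = t has a directed cycle: otherwise a
-- topological order of it would be a candidate whose pattern v satisfies.
avoiding⇒cyclic : ∀ {n t} (v : Assignment (n * n)) → Avoids v (map forcedBy (candidates n t)) →
  (I J : Subset n) → ∣ I ∣ ≡ t → ∣ J ∣ ≡ t → HasDirectedCycleIn (orientationOf v) I J
avoiding⇒cyclic {t = t} v avoids I J ∣I∣≡t ∣J∣≡t
  with cycle-or-order (orientationOf v) (t + t) I J (cong₂ _+_ ∣I∣≡t ∣J∣≡t)
... | inj₁ cycle = cycle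
... | inj₂ o = ⊥-elim (All.lookup avoids (∈-map⁺ forcedBy (order-candidate o ∣I∣≡t ∣J∣≡t))
                 (consistent⇒satisfies (forcedBy-consistent {v = v} (order o) (distinct o) (forward o))))
  where open TopologicalOrder

mainTheorem5 : (n t : ℕ) → 10 ≤ n → 1 ≤ t → n ^ 3 ≤ 2 ^ t →
    Σ (Orientation n) λ D → ((I J : Subset n) → ∣ I ∣ ≡ t → ∣ J ∣ ≡ t →
    HasDirectedCycleIn {n} D I J)
mainTheorem5 n t 10≤n 1≤t n³≤2ᵗ =
  orientationOf (proj₁ chosen) , avoiding⇒cyclic (proj₁ chosen) (proj₂ chosen)
  where
  5≤n : 5 ≤ n
  5≤n = ≤-trans (s≤s (s≤s (s≤s (s≤s (s≤s z≤n))))) 10≤n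
  chosen : ∃ λ v → Avoids v (map forcedBy (candidates n t))
  chosen = avoid (n * n) (map forcedBy (candidates n t)) (candidates-light n t 5≤n 1≤t n³≤2ᵗ)
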